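{- For every integer $i\ge1$, every poset $D_\mu\in\mathfrak{D}_i$ is LE-cactus.
   Context: For a finite poset $X$ with $|X|=N$, a linear extension is a bijection $f:X\to\{1,\ldots,N\}$ with $f(a)<f(b)$ whenever $a<_X b$. For $1\le i\le N-1$ the Bender–Knuth involution $t_i$ swaps labels $i$ and $i+1$ of a linear extension if $f^{ -1}(i)$, $f^{ -1}(i+1)$ are incomparable, and does nothing otherwise. Products denote composition, rightmost first. $q_0=\mathrm{id}$, $q_i=t_1(t_2t_1)\cdots(t_it_{i-1}\cdots t_1)$, $q_{jk}=q_{k-1}q_{k-j}q_{k-1}$. $X$ is LE-cactus if $(t_iq_{jk})^2$ is the identity on linear extensions of $X$ for all $1\le i$, $i+1<j<k\le |X|$. $C_m$ is the $m$-element chain, $+$ is disjoint union. For $n>1$, $\mathfrak{D}_n$ is the set of posets $C_{\lambda_1}+\cdots+C_{\lambda_\ell}$ with $\lambda$ a partition of $n$ with $\ell>1$ parts; $\mathfrak{D}_1=\{C_1\}$. -}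

module Defs where

open import Level using (Level; _⊔_) renaming (suc to lsuc)
open import Data.Nat using (ℕ; zero; suc; _+_; _∸_; _<_; _≤_; _≥_; _<?_)
open import Data.Nat.Properties using (_≟_)
open import Data.Fin using (Fin; toℕ) renaming (zero to fzero; suc to fsuc)
import Data.Fin.Properties as FinP
open import Data.List using (List; []; _∷_; _++_; length; lookup)
open import Data.Nat.ListAction using (sum)
open import Data.List.Relation.Unary.All using (All)
open import Data.List.Relation.Unary.Linked using (Linked)
open import Data.Maybe using (Maybe; just; nothing)
import Data.Maybe as Maybe
open import Data.Product using (Σ; _×_; _,_; proj₁; proj₂)
open import Data.Sum using (_⊎_)
open import Data.Empty using (⊥)
open import Relation.Binary.PropositionalEquality using (_≡_)
open import Relation.Nullary using (Dec; yes; no; ¬_)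
open import Relation.Nullary.Decidable using (_×-dec_; _⊎-dec_)

record StrictPoset : Set₁ where
  field
    Carrier : Set
    _≺_     : Carrier → Carrier → Set
    _≺?_    : (a b : Carrier) → Dec (a ≺ b)

  Comparable : Carrier → Carrier → Set
  Comparable a b = (a ≺ b) ⊎ (b ≺ a)

  comparable? : (a b : Carrier) → Dec (Comparable a b)
  comparable? a b = (a ≺? b) ⊎-dec (b ≺? a)

-- Linear extensions of a poset X with |X| = N : bijections f : X → Fin N
-- (label k+1 is represented by Fin element k) that are order preserving.
-- We record the inverse g = f⁻¹ explicitly.

record LinExt (P : StrictPoset) (N : ℕ) : Set where
  open StrictPoset P
  field
    f     : Carrier → Fin N
    g     : Fin N → Carrier
    g∘f   : ∀ x → g (f x) ≡ x
    f∘g   : ∀ m → f (g m) ≡ m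
    mono  : ∀ {a b} → a ≺ b → toℕ (f a) < toℕ (f b)

toFin : (N m : ℕ) → Maybe (Fin N)
toFin zero    _       = nothing
toFin (suc N) zero    = just fzero
toFin (suc N) (suc m) = Maybe.map fsuc (toFin N m)

swapFin : ∀ {N} → Fin N → Fin N → Fin N → Fin N
swapFin a b x with x FinP.≟ a
... | yes _ = b
... | no _ with x FinP.≟ b
...   | yes _ = a
...   | no _  = x

-- Bender–Knuth involution t_i (1 ≤ i ≤ N-1), acting on a labelling via
-- its inverse g = f⁻¹ : Fin N → X.  Labels i and i+1 are the Fin
-- elements i-1 and i.
-- Out of range indices act as the identity (never used below).

BK : (P : StrictPoset) (N : ℕ) → ℕ → (Fin N → StrictPoset.Carrier P)
   → (Fin N → StrictPoset.Carrier P)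
BK P N zero g = g
BK P N (suc i) g with toFin N i | toFin N (suc i)
... | just a | just b with StrictPoset.comparable? P (g a) (g b)
...   | yes _ = g
...   | no _  = λ x → g (swapFin a b x)
BK P N (suc i) g | _ | _ = g

-- words in the t_i, written left to right; the product acts rightmost first
act : (P : StrictPoset) (N : ℕ) → List ℕ → (Fin N → StrictPoset.Carrier P)
    → (Fin N → StrictPoset.Carrier P)
act P N []      g = g
act P N (a ∷ w) g = BK P N a (act P N w g)

block : ℕ → List ℕ
block zero    = []
block (suc i) = suc i ∷ block i

-- q_0 = id, q_i = t_1 (t_2 t_1) ⋯ (t_i ⋯ t_1)
q : ℕ → List ℕ
q zero    = []
q (suc i) = q i ++ block (suc i)

qjk : ℕ → ℕ → List ℕ
qjk j k = q (k ∸ 1) ++ q (k ∸ j) ++ q (k ∸ 1)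

cactusWord : ℕ → ℕ → ℕ → List ℕ
cactusWord i j k = (i ∷ qjk j k) ++ (i ∷ qjk j k)

-- LE-cactus, for a poset P with |P| = N.  The action on f is
-- determined by (and determines) the action on g = f⁻¹.
IsLECactus : (P : StrictPoset) (N : ℕ) → Set
IsLECactus P N =
  ∀ i j k → 1 ≤ i → suc i < j → j < k → k ≤ N →
  (L : LinExt P N) → ∀ x →
  act P N (cactusWord i j k) (LinExt.g L) x ≡ LinExt.g L x

chains : List ℕ → StrictPoset
chains λs = record
  { Carrier = Σ (Fin (length λs)) (λ c → Fin (lookup λs c))
  ; _≺_     = λ a b → (proj₁ a ≡ proj₁ b) × (toℕ (proj₂ a) < toℕ (proj₂ b))
  ; _≺?_    = λ a b → (proj₁ a FinP.≟ proj₁ b) ×-dec (toℕ (proj₂ a) <? toℕ (proj₂ b))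
  }

_≥′_ : ℕ → ℕ → Set
a ≥′ b = b ≤ a

IsPartition : ℕ → List ℕ → Set
IsPartition n λs = All (λ p → 1 ≤ p) λs × Linked _≥′_ λs × sum λs ≡ n

-- λs ∈ 𝔇ₙ (identifying the poset with its list of chain lengths)
InD : ℕ → List ℕ → Set
InD zero          λs = ⊥
InD (suc zero)    λs = λs ≡ 1 ∷ []
InD (suc (suc n)) λs = IsPartition (suc (suc n)) λs × 1 < length λs

-- For a disjoint union of chains, a linear extension is determined by its colour
-- sequence (which chain carries each label), because inside one chain the labels
-- must increase.  A Bender–Knuth move t_i either swaps two incomparable elements or
-- leaves two elements of one chain in place; either way it permutes the colour
-- sequence by the transposition of the positions i and i+1.  So a word in the t_i
-- acts on colour sequences through the corresponding permutation of positions, and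
-- (t_i q_jk)² acts trivially there: q_jk reverses the interval [j, k], which is
-- disjoint from {i, i+1}.

module Submission where

open import Defs
open import Data.Empty using (⊥-elim)
open import Data.Fin using (Fin; toℕ; fromℕ<)
open import Data.Fin.Induction using (<-wellFounded)
open import Data.Fin.Properties using (toℕ-injective; toℕ-fromℕ<) renaming (_≟_ to _≟ᶠ_)
open import Data.List using (List; []; _∷_; _++_)
open import Data.List.Relation.Unary.All using (All; []; _∷_) renaming (map to All-map)
open import Data.List.Relation.Unary.All.Properties using (++⁺)
open import Data.Maybe using (just; nothing)
import Data.Maybe as Maybe
open import Data.Nat using (ℕ; zero; suc; _∸_; _<_; _≤_; z≤n; s≤s; _≤?_; _<?_)
open import Data.Nat.ListAction using (sum)
open import Data.Nat.Properties
open import Data.Product using (_×_; _,_; proj₁)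
open import Data.Sum using (_⊎_; inj₁; inj₂; map)
open import Function using (_∘_)
open import Induction.WellFounded using (module All)
open import Relation.Binary.Definitions using (tri<; tri≈; tri>)
open import Relation.Binary.PropositionalEquality
open import Relation.Nullary using (¬_; yes; no)

swapAdj : ℕ → ℕ → ℕ
swapAdj zero    zero          = 1
swapAdj zero    (suc zero)    = 0
swapAdj zero    (suc (suc x)) = suc (suc x)
swapAdj (suc p) zero          = zero
swapAdj (suc p) (suc x)       = suc (swapAdj p x)

swapAdj-involutive : ∀ p x → swapAdj p (swapAdj p x) ≡ x
swapAdj-involutive zero    zero          = refl
swapAdj-involutive zero    (suc zero)    = refl
swapAdj-involutive zero    (suc (suc x)) = refl
swapAdj-involutive (suc p) zero          = refl
swapAdj-involutive (suc p) (suc x)       = cong suc (swapAdj-involutive p x)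

swapAdj-left : ∀ p → swapAdj p p ≡ suc p
swapAdj-left zero    = refl
swapAdj-left (suc p) = cong suc (swapAdj-left p)

swapAdj-right : ∀ p → swapAdj p (suc p) ≡ p
swapAdj-right p = trans (cong (swapAdj p) (sym (swapAdj-left p))) (swapAdj-involutive p p)

swapAdj-fixes : ∀ p x → x ≢ p → x ≢ suc p → swapAdj p x ≡ x
swapAdj-fixes zero    zero          x≢p _    = ⊥-elim (x≢p refl)
swapAdj-fixes zero    (suc zero)    _   x≢sp = ⊥-elim (x≢sp refl)
swapAdj-fixes zero    (suc (suc x)) _   _    = refl
swapAdj-fixes (suc p) zero          _   _    = refl
swapAdj-fixes (suc p) (suc x)       x≢p x≢sp =
  cong suc (swapAdj-fixes p x (x≢p ∘ cong suc) (x≢sp ∘ cong suc))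

swapAdj-reflects-< : ∀ p x y → swapAdj p x < swapAdj p y → x < y ⊎ (x ≡ suc p × y ≡ p)
swapAdj-reflects-< zero zero          zero          (s≤s ())
swapAdj-reflects-< zero zero          (suc zero)    ()
swapAdj-reflects-< zero zero          (suc (suc y)) _  = inj₁ (s≤s z≤n)
swapAdj-reflects-< zero (suc zero)    zero          _  = inj₂ (refl , refl)
swapAdj-reflects-< zero (suc zero)    (suc (suc y)) _  = inj₁ (s≤s (s≤s z≤n))
swapAdj-reflects-< zero (suc (suc x)) zero          (s≤s ())
swapAdj-reflects-< zero (suc (suc x)) (suc (suc y)) lt = inj₁ lt
swapAdj-reflects-< (suc p) zero    (suc y) _       = inj₁ (s≤s z≤n)
swapAdj-reflects-< (suc p) (suc x) (suc y) (s≤s lt) =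
  map s≤s (λ { (refl , refl) → refl , refl }) (swapAdj-reflects-< p x y lt)

-- Positions are 0-based: t_i swaps the positions i-1 and i, and t_0 acts as the
-- identity, as BK does.
τ : ℕ → ℕ → ℕ
τ zero    x = x
τ (suc p) x = swapAdj p x

τ-involutive : ∀ i x → τ i (τ i x) ≡ x
τ-involutive zero    x = refl
τ-involutive (suc p) x = swapAdj-involutive p x

τ-fixes-> : ∀ i x → i < x → τ i x ≡ x
τ-fixes-> zero    x _    = refl
τ-fixes-> (suc p) x sp<x = swapAdj-fixes p x (>⇒≢ (<-trans (n<1+n p) sp<x)) (>⇒≢ sp<x)

⟦_⟧ : List ℕ → ℕ → ℕ
⟦ []    ⟧ x = x
⟦ a ∷ w ⟧ x = ⟦ w ⟧ (τ a x)

⟦++⟧ : ∀ u v x → ⟦ u ++ v ⟧ x ≡ ⟦ v ⟧ (⟦ u ⟧ x)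
⟦++⟧ []      v x = refl
⟦++⟧ (a ∷ u) v x = ⟦++⟧ u v (τ a x)

⟦block⟧-above : ∀ n x → n < x → ⟦ block n ⟧ x ≡ x
⟦block⟧-above zero    x _    = refl
⟦block⟧-above (suc n) x sn<x =
  trans (cong ⟦ block n ⟧ (τ-fixes-> (suc n) x sn<x)) (⟦block⟧-above n x (<-trans (n<1+n n) sn<x))

⟦block⟧-top : ∀ n → ⟦ block n ⟧ n ≡ 0
⟦block⟧-top zero    = refl
⟦block⟧-top (suc n) = trans (cong ⟦ block n ⟧ (swapAdj-right n)) (⟦block⟧-top n)

⟦block⟧-below : ∀ n x → x < n → ⟦ block n ⟧ x ≡ suc x
⟦block⟧-below (suc n) x x<sn with m≤n⇒m<n∨m≡n (≤-pred x<sn)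
... | inj₁ x<n  = trans (cong ⟦ block n ⟧ (swapAdj-fixes n x (<⇒≢ x<n) (<⇒≢ x<sn))) (⟦block⟧-below n x x<n)
... | inj₂ refl = trans (cong ⟦ block n ⟧ (swapAdj-left n)) (⟦block⟧-above n (suc n) (n<1+n n))

⟦q⟧-above : ∀ n x → n < x → ⟦ q n ⟧ x ≡ x
⟦q⟧-above zero    x _    = refl
⟦q⟧-above (suc n) x sn<x = begin
  ⟦ q n ++ block (suc n) ⟧ x      ≡⟨ ⟦++⟧ (q n) (block (suc n)) x ⟩
  ⟦ block (suc n) ⟧ (⟦ q n ⟧ x)   ≡⟨ cong ⟦ block (suc n) ⟧ (⟦q⟧-above n x (<-trans (n<1+n n) sn<x)) ⟩
  ⟦ block (suc n) ⟧ x             ≡⟨ ⟦block⟧-above (suc n) x sn<x ⟩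
  x                               ∎
  where open ≡-Reasoning

⟦q⟧-below : ∀ n x → x ≤ n → ⟦ q n ⟧ x ≡ n ∸ x
⟦q⟧-below zero    zero _    = refl
⟦q⟧-below (suc n) x x≤sn = trans (⟦++⟧ (q n) (block (suc n)) x) (step (m≤n⇒m<n∨m≡n x≤sn))
  where
  step : x < suc n ⊎ x ≡ suc n → ⟦ block (suc n) ⟧ (⟦ q n ⟧ x) ≡ suc n ∸ x
  step (inj₁ x<sn) = begin
    ⟦ block (suc n) ⟧ (⟦ q n ⟧ x) ≡⟨ cong ⟦ block (suc n) ⟧ (⟦q⟧-below n x (≤-pred x<sn)) ⟩
    ⟦ block (suc n) ⟧ (n ∸ x)     ≡⟨ ⟦block⟧-below (suc n) (n ∸ x) (s≤s (m∸n≤m n x)) ⟩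
    suc (n ∸ x)                   ≡⟨ sym (+-∸-assoc 1 (≤-pred x<sn)) ⟩
    suc n ∸ x                     ∎
    where open ≡-Reasoning
  step (inj₂ refl) = begin
    ⟦ block (suc n) ⟧ (⟦ q n ⟧ (suc n)) ≡⟨ cong ⟦ block (suc n) ⟧ (⟦q⟧-above n (suc n) (n<1+n n)) ⟩
    ⟦ block (suc n) ⟧ (suc n)           ≡⟨ ⟦block⟧-top (suc n) ⟩
    0                                   ≡⟨ sym (n∸n≡0 n) ⟩
    n ∸ n                               ∎
    where open ≡-Reasoning

⟦q⟧-involutive : ∀ n x → ⟦ q n ⟧ (⟦ q n ⟧ x) ≡ x
⟦q⟧-involutive n x with x ≤? n
... | yes x≤n = begin
  ⟦ q n ⟧ (⟦ q n ⟧ x) ≡⟨ cong ⟦ q n ⟧ (⟦q⟧-below n x x≤n) ⟩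
  ⟦ q n ⟧ (n ∸ x)     ≡⟨ ⟦q⟧-below n (n ∸ x) (m∸n≤m n x) ⟩
  n ∸ (n ∸ x)         ≡⟨ m∸[m∸n]≡n x≤n ⟩
  x                   ∎
  where open ≡-Reasoning
... | no x≰n = trans (cong ⟦ q n ⟧ (⟦q⟧-above n x n<x)) (⟦q⟧-above n x n<x)
  where
  n<x : n < x
  n<x = ≰⇒> x≰n

⟦qjk⟧ : ∀ j k x → ⟦ qjk (suc j) (suc k) ⟧ x ≡ ⟦ q k ⟧ (⟦ q (k ∸ j) ⟧ (⟦ q k ⟧ x))
⟦qjk⟧ j k x = trans (⟦++⟧ (q k) (q (k ∸ j) ++ q k) x) (⟦++⟧ (q (k ∸ j)) (q k) (⟦ q k ⟧ x))

⟦qjk⟧-involutive : ∀ j k x → ⟦ qjk (suc j) (suc k) ⟧ (⟦ qjk (suc j) (suc k) ⟧ x) ≡ x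
⟦qjk⟧-involutive j k x = begin
  ⟦ qjk (suc j) (suc k) ⟧ (⟦ qjk (suc j) (suc k) ⟧ x)
    ≡⟨ trans (⟦qjk⟧ j k _) (cong (λ y → ⟦ q k ⟧ (⟦ q (k ∸ j) ⟧ (⟦ q k ⟧ y))) (⟦qjk⟧ j k x)) ⟩
  ⟦ q k ⟧ (⟦ q (k ∸ j) ⟧ (⟦ q k ⟧ (⟦ q k ⟧ (⟦ q (k ∸ j) ⟧ (⟦ q k ⟧ x)))))
    ≡⟨ cong (λ y → ⟦ q k ⟧ (⟦ q (k ∸ j) ⟧ y)) (⟦q⟧-involutive k _) ⟩
  ⟦ q k ⟧ (⟦ q (k ∸ j) ⟧ (⟦ q (k ∸ j) ⟧ (⟦ q k ⟧ x)))
    ≡⟨ cong ⟦ q k ⟧ (⟦q⟧-involutive (k ∸ j) _) ⟩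
  ⟦ q k ⟧ (⟦ q k ⟧ x)
    ≡⟨ ⟦q⟧-involutive k x ⟩
  x ∎
  where open ≡-Reasoning

⟦qjk⟧-fixes-< : ∀ j k x → j ≤ k → x < j → ⟦ qjk (suc j) (suc k) ⟧ x ≡ x
⟦qjk⟧-fixes-< j k x j≤k x<j = begin
  ⟦ qjk (suc j) (suc k) ⟧ x                   ≡⟨ ⟦qjk⟧ j k x ⟩
  ⟦ q k ⟧ (⟦ q (k ∸ j) ⟧ (⟦ q k ⟧ x))         ≡⟨ cong (λ y → ⟦ q k ⟧ (⟦ q (k ∸ j) ⟧ y)) kx ⟩
  ⟦ q k ⟧ (⟦ q (k ∸ j) ⟧ (k ∸ x))             ≡⟨ cong ⟦ q k ⟧ (⟦q⟧-above (k ∸ j) (k ∸ x) (∸-monoʳ-< x<j j≤k)) ⟩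
  ⟦ q k ⟧ (k ∸ x)                             ≡⟨ cong ⟦ q k ⟧ (sym kx) ⟩
  ⟦ q k ⟧ (⟦ q k ⟧ x)                         ≡⟨ ⟦q⟧-involutive k x ⟩
  x                                           ∎
  where
  open ≡-Reasoning
  kx : ⟦ q k ⟧ x ≡ k ∸ x
  kx = ⟦q⟧-below k x (<⇒≤ (<-≤-trans x<j j≤k))

separated-involutions-commute : (f g : ℕ → ℕ) (b : ℕ) →
  (∀ x → f (f x) ≡ x) → (∀ x → g (g x) ≡ x) →
  (∀ x → x < b → f x ≡ x) → (∀ x → b ≤ x → g x ≡ x) →
  ∀ x → f (g (f (g x))) ≡ x
separated-involutions-commute f g b f-inv g-inv f-fix g-fix x with x <? b
... | yes x<b = begin
  f (g (f (g x))) ≡⟨ cong (λ y → f (g y)) (f-fix (g x) gx<b) ⟩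
  f (g (g x))     ≡⟨ cong f (g-inv x) ⟩
  f x             ≡⟨ f-fix x x<b ⟩
  x               ∎
  where
  open ≡-Reasoning
  gx<b : g x < b
  gx<b = ≰⇒> λ b≤gx → <⇒≱ x<b (subst (b ≤_) (trans (sym (g-fix (g x) b≤gx)) (g-inv x)) b≤gx)
... | no x≮b = begin
  f (g (f (g x))) ≡⟨ cong (λ y → f (g (f y))) (g-fix x b≤x) ⟩
  f (g (f x))     ≡⟨ cong f (g-fix (f x) b≤fx) ⟩
  f (f x)         ≡⟨ f-inv x ⟩
  x               ∎
  where
  open ≡-Reasoning
  b≤x : b ≤ x
  b≤x = ≮⇒≥ x≮b
  b≤fx : b ≤ f x
  b≤fx = ≮⇒≥ λ fx<b → <⇒≱ (subst (_< b) (trans (sym (f-fix (f x) fx<b)) (f-inv x)) fx<b) b≤x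

⟦cactusWord⟧ : ∀ i j k → i < j → j ≤ k → ∀ x → ⟦ cactusWord i (suc j) (suc k) ⟧ x ≡ x
⟦cactusWord⟧ i j k i<j j≤k x =
  trans (⟦++⟧ (i ∷ qjk (suc j) (suc k)) (i ∷ qjk (suc j) (suc k)) x)
        (separated-involutions-commute ⟦ qjk (suc j) (suc k) ⟧ (τ i) j
          (⟦qjk⟧-involutive j k) (τ-involutive i)
          (λ y y<j → ⟦qjk⟧-fixes-< j k y j≤k y<j) (λ y j≤y → τ-fixes-> i y (<-≤-trans i<j j≤y)) x)

block-bounded : ∀ n → All (_≤ n) (block n)
block-bounded zero    = []
block-bounded (suc n) = ≤-refl ∷ All-map m≤n⇒m≤1+n (block-bounded n)

q-bounded : ∀ n → All (_≤ n) (q n)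
q-bounded zero    = []
q-bounded (suc n) = ++⁺ (All-map m≤n⇒m≤1+n (q-bounded n)) (block-bounded (suc n))

cactusWord-bounded : ∀ i j k → i ≤ k → All (_≤ k) (cactusWord i (suc j) (suc k))
cactusWord-bounded i j k i≤k = ++⁺ (i≤k ∷ qjk-bounded) (i≤k ∷ qjk-bounded)
  where
  qjk-bounded : All (_≤ k) (qjk (suc j) (suc k))
  qjk-bounded = ++⁺ (q-bounded k) (++⁺ (All-map (λ p → ≤-trans p (m∸n≤m k j)) (q-bounded (k ∸ j))) (q-bounded k))

toFin-fromℕ< : ∀ {N m} (m<N : m < N) → toFin N m ≡ just (fromℕ< m<N)
toFin-fromℕ< {suc N} {zero}  _         = refl
toFin-fromℕ< {suc N} {suc m} (s≤s m<N) = cong (Maybe.map Fin.suc) (toFin-fromℕ< m<N)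

toFin-just : ∀ N m {a} → toFin N m ≡ just a → toℕ a ≡ m
toFin-just (suc N) zero    refl = refl
toFin-just (suc N) (suc m) e with toFin N m in e′
toFin-just (suc N) (suc m) refl | just a = cong suc (toFin-just N m e′)

toℕ-swapFin : ∀ {N} (a b x : Fin N) → toℕ b ≡ suc (toℕ a) →
  toℕ (swapFin a b x) ≡ swapAdj (toℕ a) (toℕ x)
toℕ-swapFin a b x b≡sa with x ≟ᶠ a
... | yes refl = trans b≡sa (sym (swapAdj-left (toℕ x)))
... | no x≢a with x ≟ᶠ b
...   | yes refl = sym (trans (cong (swapAdj (toℕ a)) b≡sa) (swapAdj-right (toℕ a)))
...   | no x≢b = sym (swapAdj-fixes (toℕ a) (toℕ x)
                   (x≢a ∘ toℕ-injective) (x≢b ∘ toℕ-injective ∘ (λ e → trans e (sym b≡sa))))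

swapFin-involutive : ∀ {N} (a b x : Fin N) → toℕ b ≡ suc (toℕ a) → swapFin a b (swapFin a b x) ≡ x
swapFin-involutive a b x b≡sa = toℕ-injective (begin
  toℕ (swapFin a b (swapFin a b x))         ≡⟨ toℕ-swapFin a b _ b≡sa ⟩
  swapAdj (toℕ a) (toℕ (swapFin a b x))     ≡⟨ cong (swapAdj (toℕ a)) (toℕ-swapFin a b x b≡sa) ⟩
  swapAdj (toℕ a) (swapAdj (toℕ a) (toℕ x)) ≡⟨ swapAdj-involutive (toℕ a) (toℕ x) ⟩
  toℕ x                                     ∎)
  where open ≡-Reasoning

swapFin-respects : ∀ {N} {A : Set} (c : Fin N → A) (a b : Fin N) → c a ≡ c b → ∀ m → c (swapFin a b m) ≡ c m
swapFin-respects c a b ca≡cb m with m ≟ᶠ a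
... | yes refl = sym ca≡cb
... | no _ with m ≟ᶠ b
...   | yes refl = ca≡cb
...   | no _     = refl

module Positions (N : ℕ) where

  τᶠ : ℕ → Fin N → Fin N
  τᶠ zero    x = x
  τᶠ (suc i) x with toFin N i | toFin N (suc i)
  ... | just a | just b = swapFin a b x
  ... | _      | _      = x

  toℕ-τᶠ : ∀ i x → i < N → toℕ (τᶠ i x) ≡ τ i (toℕ x)
  toℕ-τᶠ zero    x _    = refl
  toℕ-τᶠ (suc i) x si<N rewrite toFin-fromℕ< (<-trans (n<1+n i) si<N) | toFin-fromℕ< si<N =
    trans (toℕ-swapFin a b x b≡sa) (cong (λ p → swapAdj p (toℕ x)) (toℕ-fromℕ< i<N))
    where
    i<N : i < N
    i<N = <-trans (n<1+n i) si<N
    a b : Fin N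
    a = fromℕ< i<N
    b = fromℕ< si<N
    b≡sa : toℕ b ≡ suc (toℕ a)
    b≡sa = trans (toℕ-fromℕ< si<N) (cong suc (sym (toℕ-fromℕ< i<N)))

  ⟦_⟧ᶠ : List ℕ → Fin N → Fin N
  ⟦ []    ⟧ᶠ x = x
  ⟦ a ∷ w ⟧ᶠ x = ⟦ w ⟧ᶠ (τᶠ a x)

  toℕ-⟦⟧ᶠ : ∀ w x → All (_< N) w → toℕ (⟦ w ⟧ᶠ x) ≡ ⟦ w ⟧ (toℕ x)
  toℕ-⟦⟧ᶠ []      x []         = refl
  toℕ-⟦⟧ᶠ (a ∷ w) x (a<N ∷ w<N) = trans (toℕ-⟦⟧ᶠ w (τᶠ a x) w<N) (cong ⟦ w ⟧ (toℕ-τᶠ a x a<N))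

module LinearExtensions (P : StrictPoset) (N : ℕ) where
  open StrictPoset P
  open Positions N

  record IsLinExtInverse (g : Fin N → Carrier) : Set where
    field
      f   : Carrier → Fin N
      g∘f : ∀ x → g (f x) ≡ x
      f∘g : ∀ m → f (g m) ≡ m
      ≺⇒< : ∀ m m′ → g m ≺ g m′ → toℕ m < toℕ m′

  linExt⇒inverse : (L : LinExt P N) → IsLinExtInverse (LinExt.g L)
  linExt⇒inverse L = record
    { f   = f
    ; g∘f = g∘f
    ; f∘g = f∘g
    ; ≺⇒< = λ m m′ gm≺gm′ → subst₂ _<_ (cong toℕ (f∘g m)) (cong toℕ (f∘g m′)) (mono gm≺gm′)
    }
    where open LinExt L

  swap-incomparable : ∀ {g} (a b : Fin N) → IsLinExtInverse g → toℕ b ≡ suc (toℕ a) →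
    ¬ Comparable (g a) (g b) → IsLinExtInverse (g ∘ swapFin a b)
  swap-incomparable {g} a b G b≡sa incomparable = record
    { f   = swapFin a b ∘ f
    ; g∘f = λ x → trans (cong g (swapFin-involutive a b (f x) b≡sa)) (g∘f x)
    ; f∘g = λ m → trans (cong (swapFin a b) (f∘g (swapFin a b m))) (swapFin-involutive a b m b≡sa)
    ; ≺⇒< = reflects
    }
    where
    open IsLinExtInverse G
    p : ℕ
    p = toℕ a
    reflects : ∀ m m′ → g (swapFin a b m) ≺ g (swapFin a b m′) → toℕ m < toℕ m′
    reflects m m′ rel with swapAdj-reflects-< p (toℕ m) (toℕ m′)
                             (subst₂ _<_ (toℕ-swapFin a b m b≡sa) (toℕ-swapFin a b m′ b≡sa) (≺⇒< _ _ rel))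
    ... | inj₁ m<m′ = m<m′
    ... | inj₂ (m≡sp , m′≡p) = ⊥-elim (incomparable (inj₁ (subst₂ (λ u v → g u ≺ g v) sm≡a sm′≡b rel)))
      where
      sm≡a : swapFin a b m ≡ a
      sm≡a = toℕ-injective (trans (toℕ-swapFin a b m b≡sa) (trans (cong (swapAdj p) m≡sp) (swapAdj-right p)))
      sm′≡b : swapFin a b m′ ≡ b
      sm′≡b = toℕ-injective (trans (toℕ-swapFin a b m′ b≡sa)
                (trans (cong (swapAdj p) m′≡p) (trans (swapAdj-left p) (sym b≡sa))))

  BK-preserves : ∀ i g → IsLinExtInverse g → IsLinExtInverse (BK P N i g)
  BK-preserves zero    g G = G
  BK-preserves (suc i) g G with toFin N i in eᵢ | toFin N (suc i) in eₛᵢ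
  ... | just a  | just b with comparable? (g a) (g b)
  ...   | yes _          = G
  ...   | no incomparable = swap-incomparable a b G b≡sa incomparable
    where
    b≡sa : toℕ b ≡ suc (toℕ a)
    b≡sa = trans (toFin-just N (suc i) eₛᵢ) (cong suc (sym (toFin-just N i eᵢ)))
  BK-preserves (suc i) g G | nothing | _       = G
  BK-preserves (suc i) g G | just _  | nothing = G

  act-preserves : ∀ w g → IsLinExtInverse g → IsLinExtInverse (act P N w g)
  act-preserves []      g G = G
  act-preserves (a ∷ w) g G = BK-preserves a (act P N w g) (act-preserves w g G)

module ChainDecomposition
  (P : StrictPoset) (N : ℕ) {K : Set} (colour : StrictPoset.Carrier P → K)
  (comparable⇒colour≡ : ∀ {u v} → StrictPoset.Comparable P u v → colour u ≡ colour v)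
  (colour≡⇒comparable : ∀ {u v} → colour u ≡ colour v → u ≡ v ⊎ StrictPoset.Comparable P u v)
  where
  open StrictPoset P
  open Positions N
  open LinearExtensions P N

  BK-colour : ∀ i g m → colour (BK P N i g m) ≡ colour (g (τᶠ i m))
  BK-colour zero    g m = refl
  BK-colour (suc i) g m with toFin N i | toFin N (suc i)
  ... | just a  | just b with comparable? (g a) (g b)
  ...   | yes a∼b = sym (swapFin-respects (colour ∘ g) a b (comparable⇒colour≡ a∼b) m)
  ...   | no _    = refl
  BK-colour (suc i) g m | nothing | _       = refl
  BK-colour (suc i) g m | just _  | nothing = refl

  act-colour : ∀ w g m → colour (act P N w g m) ≡ colour (g (⟦ w ⟧ᶠ m))
  act-colour []      g m = refl
  act-colour (a ∷ w) g m = trans (BK-colour a (act P N w g) m) (act-colour w g (τᶠ a m))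

  private
    -- If h m ≺ g m, then h m occupies an earlier position m′ in g, where h and g
    -- already agree; so h m′ = h m, contradicting injectivity of h.
    not-below : ∀ {g h} → IsLinExtInverse g → IsLinExtInverse h → ∀ m →
      (∀ {m′} → toℕ m′ < toℕ m → h m′ ≡ g m′) → ¬ (h m ≺ g m)
    not-below {g} {h} G H m agree hm≺gm = <-irrefl (cong toℕ m′≡m) m′<m
      where
      module G = IsLinExtInverse G
      module H = IsLinExtInverse H
      m′ : Fin N
      m′ = G.f (h m)
      m′<m : toℕ m′ < toℕ m
      m′<m = G.≺⇒< m′ m (subst (_≺ g m) (sym (G.g∘f (h m))) hm≺gm)
      m′≡m : m′ ≡ m
      m′≡m = begin
        m′             ≡⟨ H.f∘g m′ ⟨
        H.f (h m′)     ≡⟨ cong H.f (agree m′<m) ⟩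
        H.f (g m′)     ≡⟨ cong H.f (G.g∘f (h m)) ⟩
        H.f (h m)      ≡⟨ H.f∘g m ⟩
        m              ∎
        where open ≡-Reasoning

  colours-determine : ∀ {g h} → IsLinExtInverse g → IsLinExtInverse h →
    (∀ m → colour (h m) ≡ colour (g m)) → ∀ m → h m ≡ g m
  colours-determine {g} {h} G H same = All.wfRec <-wellFounded _ (λ m → h m ≡ g m) step
    where
    step : ∀ m → (∀ {m′} → toℕ m′ < toℕ m → h m′ ≡ g m′) → h m ≡ g m
    step m agree with colour≡⇒comparable (same m)
    ... | inj₁ hm≡gm         = hm≡gm
    ... | inj₂ (inj₁ hm≺gm)  = ⊥-elim (not-below G H m agree hm≺gm)
    ... | inj₂ (inj₂ gm≺hm)  = ⊥-elim (not-below H G m (sym ∘ agree) gm≺hm)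

  isLECactus : IsLECactus P N
  isLECactus i (suc j) (suc k) _ (s≤s i<j) (s≤s j<k) k<N L x =
    colours-determine G (act-preserves w g G) same-colours x
    where
    open LinExt L using (g)
    w : List ℕ
    w = cactusWord i (suc j) (suc k)
    G : IsLinExtInverse g
    G = linExt⇒inverse L
    w<N : All (_< N) w
    w<N = All-map (λ a≤k → ≤-<-trans a≤k k<N) (cactusWord-bounded i j k (<⇒≤ (<-≤-trans i<j (<⇒≤ j<k))))
    positions-fixed : ∀ m → ⟦ w ⟧ᶠ m ≡ m
    positions-fixed m = toℕ-injective (trans (toℕ-⟦⟧ᶠ w m w<N) (⟦cactusWord⟧ i j k i<j (<⇒≤ j<k) (toℕ m)))
    same-colours : ∀ m → colour (act P N w g m) ≡ colour (g m)
    same-colours m = trans (act-colour w g m) (cong (colour ∘ g) (positions-fixed m))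

chains-isLECactus : ∀ μ → IsLECactus (chains μ) (sum μ)
chains-isLECactus μ = ChainDecomposition.isLECactus (chains μ) (sum μ) proj₁ comparable⇒sameChain sameChain⇒comparable
  where
  comparable⇒sameChain : ∀ {u v} → StrictPoset.Comparable (chains μ) u v → proj₁ u ≡ proj₁ v
  comparable⇒sameChain (inj₁ (e , _)) = e
  comparable⇒sameChain (inj₂ (e , _)) = sym e
  sameChain⇒comparable : ∀ {u v} → proj₁ u ≡ proj₁ v → u ≡ v ⊎ StrictPoset.Comparable (chains μ) u v
  sameChain⇒comparable {c , r} {.c , r′} refl with <-cmp (toℕ r) (toℕ r′)
  ... | tri< r<r′ _ _ = inj₂ (inj₁ (refl , r<r′))
  ... | tri≈ _ r≡r′ _ = inj₁ (cong (c ,_) (toℕ-injective r≡r′))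
  ... | tri> _ _ r′<r = inj₂ (inj₂ (refl , r′<r))

corollary4p15 : (i : ℕ) → 1 ≤ i → (μ : List ℕ) → InD i μ →
    IsLECactus (chains μ) (sum μ)
corollary4p15 _ _ μ _ = chains-isLECactus μ
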